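{- Let $S$ be a finite non-empty set and $p:2^S\to\mathbb{Z}\cup\{ -\infty\}$ a supermodular function with $p(\emptyset)=0$ and $p(S)$ finite; let $B=\{x\in\mathbb{R}^S:\widetilde x(S)=p(S),\ \widetilde x(Z)\ge p(Z)\ \forall Z\subseteq S\}$ and let $\beta_1$ be the smallest integer for which $B\cap\mathbb{Z}^S$ has a $\beta_1$-covered element. For a $\beta_1$-covered element $m\in B\cap\mathbb{Z}^S$ let $S_1(m)=\bigcup\{T_m(t):t\in S,\ m(t)=\beta_1\}$. Then a $\beta_1$-covered element $m$ of $B\cap\mathbb{Z}^S$ is pre-decreasingly minimal if and only if $m(s)\ge\beta_1-1$ for every $s\in S_1(m)$.
   Context: $\widetilde x(Z)=\sum_{s\in Z}x(s)$. A vector is $\beta$-covered if each of its components is at most $\beta$. For $m\in B$, a set $X$ is $m$-tight if $\widetilde m(X)=p(X)$; $m$-tight sets are closed under union and intersection, and $T_m(t)$ denotes the unique smallest $m$-tight set containing $t$. A $\beta_1$-covered element of $B\cap\mathbb{Z}^S$ is pre-decreasingly minimal (pre-dec-min) if the number of its components equal to $\beta_1$ is as small as possible among all $\beta_1$-covered elements of $B\cap\mathbb{Z}^S$. -}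

module Defs where

open import Data.Nat using (ℕ; zero; suc)
open import Data.Bool using (Bool; true; false; if_then_else_)
open import Data.Vec using (Vec; []; _∷_)
open import Data.Fin using (Fin; zero; suc)
open import Data.Fin.Subset using (Subset; _∈_; _∩_; _∪_; ⊤; ⊥)
open import Data.Integer using (ℤ; _+_; _-_; _≤_; 0ℤ; 1ℤ)
open import Data.Integer.Properties using (_≟_)
open import Data.Product using (Σ; ∃; _×_; _,_)
open import Data.Unit using () renaming (⊤ to 𝟙)
open import Data.Empty renaming (⊥ to 𝟘)
open import Relation.Binary.PropositionalEquality using (_≡_)
open import Relation.Nullary using (yes; no)

data ℤ∞ : Set where
  -∞  : ℤ∞
  fin : ℤ → ℤ∞

_+∞_ : ℤ∞ → ℤ∞ → ℤ∞
-∞    +∞ _     = -∞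
fin _ +∞ -∞    = -∞
fin a +∞ fin b = fin (a + b)

_≤∞_ : ℤ∞ → ℤ∞ → Set
-∞    ≤∞ _     = 𝟙
fin _ ≤∞ -∞    = 𝟘
fin a ≤∞ fin b = a ≤ b

Supermodular : ∀ {n} → (Subset n → ℤ∞) → Set
Supermodular p = ∀ X Y → (p X +∞ p Y) ≤∞ (p (X ∩ Y) +∞ p (X ∪ Y))

tilde : ∀ {n} → (Fin n → ℤ) → Subset n → ℤ
tilde {zero}  x []      = 0ℤ
tilde {suc n} x (b ∷ Z) = (if b then x zero else 0ℤ) + tilde (λ i → x (suc i)) Z

InB : ∀ {n} → (Subset n → ℤ∞) → (Fin n → ℤ) → Set
InB p x = (fin (tilde x ⊤) ≡ p ⊤) × (∀ Z → p Z ≤∞ fin (tilde x Z))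

Covered : ∀ {n} → ℤ → (Fin n → ℤ) → Set
Covered β x = ∀ i → x i ≤ β

countEq : ∀ {n} → ℤ → (Fin n → ℤ) → ℕ
countEq {zero}  β x = 0
countEq {suc n} β x with x zero ≟ β
... | yes _ = suc (countEq β (λ i → x (suc i)))
... | no  _ = countEq β (λ i → x (suc i))

IsBeta1 : ∀ {n} → (Subset n → ℤ∞) → ℤ → Set
IsBeta1 p β₁ = (∃ λ x → InB p x × Covered β₁ x)
             × (∀ β → (∃ λ x → InB p x × Covered β x) → β₁ ≤ β)

PreDecMin : ∀ {n} → (Subset n → ℤ∞) → ℤ → (Fin n → ℤ) → Set
PreDecMin p β₁ m = InB p m × Covered β₁ m
  × (∀ y → InB p y → Covered β₁ y → countEq β₁ m Data.Nat.≤ countEq β₁ y)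

Tight : ∀ {n} → (Subset n → ℤ∞) → (Fin n → ℤ) → Subset n → Set
Tight p m X = fin (tilde m X) ≡ p X

-- s ∈ T_m(t): s lies in the smallest m-tight set containing t, i.e. in the
-- intersection of all m-tight sets containing t
InT : ∀ {n} → (Subset n → ℤ∞) → (Fin n → ℤ) → Fin n → Fin n → Set
InT p m t s = ∀ X → Tight p m X → t ∈ X → s ∈ X

InS1 : ∀ {n} → (Subset n → ℤ∞) → ℤ → (Fin n → ℤ) → Fin n → Set
InS1 p β₁ m s = ∃ λ t → (m t ≡ β₁) × InT p m t s

-- If m(s) ≤ β - 2 for some s ∈ T_m(t) with m(t) = β, move one unit from t to s:
-- the only constraints that could break belong to sets containing t but not s,
-- which are not tight, so the result is a β-covered element of B with fewer
-- β-coordinates. Conversely S₁(m), a union of tight sets, is tight and contains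
-- every β-coordinate of m. For a β-covered y ∈ B, on S₁(m) (where m ≥ β - 1)
-- y(i) + [m(i) = β] ≤ m(i) + [y(i) = β]; summing over S₁(m) and using
-- ỹ(S₁) ≥ p(S₁) = m̃(S₁) shows that y has at least as many β-coordinates in
-- S₁(m) as m has in all of S.
module Submission where

open import Defs
open import Algebra.Properties.CommutativeSemigroup using (interchange)
open import Data.Bool using (Bool; true; false; if_then_else_; _∧_; _∨_)
open import Data.Empty using (⊥-elim)
open import Data.Fin using (Fin; zero; suc)
open import Data.Fin.Properties using () renaming (_≟_ to _≟ᶠ_)
open import Data.Fin.Subset using (Subset; _∈_; _∉_; _⊆_; _∩_; _∪_; ⊤; ⊥; ⋂; ⋃)
open import Data.Fin.Subset.Properties
  using (_∈?_; ∈⊤; ∉⊥; drop-there; x∈p∩q⁺; x∈p∪q⁻; p∩q⊆p; p∩q⊆q; p⊆p∪q; q⊆p∪q)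
open import Data.Integer using (ℤ; +_; _+_; _-_; -_; _≤_; _<_; +≤+; 0ℤ; 1ℤ; -1ℤ)
open import Data.Integer.Properties
open import Data.Integer.Tactic.RingSolver using (solve-∀)
open import Data.List using (List; []; _∷_; _++_; map; filter; allFin)
open import Data.List.Membership.Propositional using (find) renaming (_∈_ to _∈ˡ_)
open import Data.List.Membership.Propositional.Properties
  using (∈-++⁺ˡ; ∈-++⁺ʳ; ∈-map⁺; ∈-filter⁺; ∈-filter⁻; ∈-allFin)
open import Data.List.Relation.Unary.All as All using (All; []; _∷_)
import Data.List.Relation.Unary.All.Properties as All
open import Data.List.Relation.Unary.Any using (Any; here; there)
import Data.List.Relation.Unary.Any.Properties as Any
open import Data.Nat as ℕ using (ℕ; zero; suc)
import Data.Nat.Properties as ℕ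
open import Data.Product using (∃; _×_; _,_; proj₁; proj₂)
open import Data.Sum using (inj₁; inj₂)
open import Data.Vec using ([]; _∷_; here; there)
open import Function using (_∘_)
open import Function.Bundles using (_⇔_; mk⇔; Equivalence)
open import Relation.Binary.Definitions using (DecidableEquality)
open import Relation.Binary.PropositionalEquality
open import Relation.Nullary using (Dec; yes; no; does; _×-dec_)
open import Relation.Nullary.Decidable using (dec-true; dec-false)

+-cancelˡ-≤ : ∀ i {j k} → i + j ≤ i + k → j ≤ k
+-cancelˡ-≤ i i+j≤i+k = ≮⇒≥ (λ k<j → <⇒≱ (+-monoʳ-< i k<j) i+j≤i+k)

+-cancelʳ-≤ : ∀ {i j} k → i + k ≤ j + k → i ≤ j
+-cancelʳ-≤ {i} {j} k = +-cancelˡ-≤ k ∘ subst₂ _≤_ (+-comm i k) (+-comm j k)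

+-interchange : ∀ a b c d → (a + b) + (c + d) ≡ (a + c) + (b + d)
+-interchange = interchange +-commutativeSemigroup

<⇒+1≤ : ∀ {a b} → a < b → a + 1ℤ ≤ b
<⇒+1≤ {a} a<b = subst (_≤ _) (+-comm 1ℤ a) (i<j⇒suc[i]≤j a<b)

<⇒≤-1 : ∀ {a b} → a < b → a ≤ b - 1ℤ
<⇒≤-1 {b = b} a<b = subst (_ ≤_) (+-comm -1ℤ b) (i<j⇒i≤pred[j] a<b)

i-1<i : ∀ i → i - 1ℤ < i
i-1<i i = i≤pred[j]⇒i<j (≤-reflexive (+-comm i -1ℤ))

i-1+1≡i : ∀ i → i - 1ℤ + 1ℤ ≡ i
i-1+1≡i = solve-∀

i+1-1≡i : ∀ i → i + 1ℤ - 1ℤ ≡ i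
i+1-1≡i = solve-∀

fin-injective : ∀ {a b} → fin a ≡ fin b → a ≡ b
fin-injective refl = refl

_≟∞_ : DecidableEquality ℤ∞
-∞    ≟∞ -∞    = yes refl
-∞    ≟∞ fin _ = no λ ()
fin _ ≟∞ -∞    = no λ ()
fin a ≟∞ fin b with a ≟ b
... | yes refl = yes refl
... | no  a≢b  = no (a≢b ∘ fin-injective)

≤∞-trans-≤ : ∀ u {a b} → u ≤∞ fin a → a ≤ b → u ≤∞ fin b
≤∞-trans-≤ -∞      _   _   = _
≤∞-trans-≤ (fin _) u≤a a≤b = ≤-trans u≤a a≤b

≤∞∧≢⇒≤-1 : ∀ u {a} → u ≤∞ fin a → fin a ≢ u → u ≤∞ fin (a - 1ℤ)
≤∞∧≢⇒≤-1 -∞      _   _   = _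
≤∞∧≢⇒≤-1 (fin c) c≤a a≢c = <⇒≤-1 (≤∧≢⇒< c≤a (a≢c ∘ cong fin ∘ sym))

≤∞-squeeze : ∀ u v {e f} → u ≤∞ fin e → v ≤∞ fin f → fin (e + f) ≤∞ (u +∞ v)
           → fin e ≡ u × fin f ≡ v
≤∞-squeeze -∞      _       _ _ ()
≤∞-squeeze (fin _) -∞      _ _ ()
≤∞-squeeze (fin c) (fin d) {e} {f} c≤e d≤f e+f≤c+d =
    cong fin (≤-antisym (+-cancelʳ-≤ f (≤-trans e+f≤c+d (+-monoʳ-≤ c d≤f))) c≤e)
  , cong fin (≤-antisym (+-cancelˡ-≤ e (≤-trans e+f≤c+d (+-monoˡ-≤ d c≤e))) d≤f)

suc-∉ : ∀ {n} {i : Fin n} {b Z} → i ∉ Z → suc i ∉ b ∷ Z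
suc-∉ i∉Z = i∉Z ∘ drop-there

tilde-vanishing : ∀ {n} {x : Fin n → ℤ} Z → (∀ i → i ∈ Z → x i ≡ 0ℤ) → tilde x Z ≡ 0ℤ
tilde-vanishing []          _  = refl
tilde-vanishing (true ∷ Z)  x≡0 = cong₂ _+_ (x≡0 zero here) (tilde-vanishing Z (λ i → x≡0 (suc i) ∘ there))
tilde-vanishing (false ∷ Z) x≡0 = trans (+-identityˡ _) (tilde-vanishing Z (λ i → x≡0 (suc i) ∘ there))

tilde-+ : ∀ {n} (x y : Fin n → ℤ) Z → tilde (λ i → x i + y i) Z ≡ tilde x Z + tilde y Z
tilde-+ x y []          = refl
tilde-+ x y (true ∷ Z)  =
  trans (cong (_+_ (x zero + y zero)) (tilde-+ (x ∘ suc) (y ∘ suc) Z))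
        (+-interchange (x zero) (y zero) (tilde (x ∘ suc) Z) (tilde (y ∘ suc) Z))
tilde-+ x y (false ∷ Z) =
  trans (+-identityˡ _) (trans (tilde-+ (x ∘ suc) (y ∘ suc) Z)
    (sym (cong₂ _+_ (+-identityˡ (tilde (x ∘ suc) Z)) (+-identityˡ (tilde (y ∘ suc) Z)))))

tilde-neg : ∀ {n} (x : Fin n → ℤ) Z → tilde (λ i → - x i) Z ≡ - tilde x Z
tilde-neg x []          = refl
tilde-neg x (true ∷ Z)  =
  trans (cong (_+_ (- x zero)) (tilde-neg (x ∘ suc) Z)) (sym (neg-distrib-+ (x zero) _))
tilde-neg x (false ∷ Z) =
  trans (+-identityˡ _) (trans (tilde-neg (x ∘ suc) Z) (cong -_ (sym (+-identityˡ _))))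

tilde-∩-∪ : ∀ {n} (x : Fin n → ℤ) X Y → tilde x (X ∩ Y) + tilde x (X ∪ Y) ≡ tilde x X + tilde x Y
tilde-∩-∪ x []      []      = refl
tilde-∩-∪ x (b ∷ X) (c ∷ Y) = begin
  (h (b ∧ c) + tilde x′ (X ∩ Y)) + (h (b ∨ c) + tilde x′ (X ∪ Y)) ≡⟨ +-interchange (h (b ∧ c)) _ (h (b ∨ c)) _ ⟩
  (h (b ∧ c) + h (b ∨ c)) + (tilde x′ (X ∩ Y) + tilde x′ (X ∪ Y)) ≡⟨ cong₂ _+_ (head b c) (tilde-∩-∪ x′ X Y) ⟩
  (h b + h c) + (tilde x′ X + tilde x′ Y)                         ≡⟨ +-interchange (h b) (h c) _ _ ⟩
  (h b + tilde x′ X) + (h c + tilde x′ Y)                         ∎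
  where
  open ≡-Reasoning
  x′ = x ∘ suc
  h : Bool → ℤ
  h b = if b then x zero else 0ℤ
  head : ∀ b c → h (b ∧ c) + h (b ∨ c) ≡ h b + h c
  head true  true  = refl
  head true  false = +-comm 0ℤ (x zero)
  head false c     = refl

tilde-mono : ∀ {n} {x y : Fin n → ℤ} Z → (∀ i → i ∈ Z → x i ≤ y i) → tilde x Z ≤ tilde y Z
tilde-mono []          _   = ≤-refl
tilde-mono (true ∷ Z)  x≤y = +-mono-≤ (x≤y zero here) (tilde-mono Z (λ i → x≤y (suc i) ∘ there))
tilde-mono (false ∷ Z) x≤y = +-monoʳ-≤ 0ℤ (tilde-mono Z (λ i → x≤y (suc i) ∘ there))

tilde-≤-⊤ : ∀ {n} {x : Fin n → ℤ} Z → (∀ i → i ∉ Z → 0ℤ ≤ x i) → tilde x Z ≤ tilde x ⊤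
tilde-≤-⊤         []          _   = ≤-refl
tilde-≤-⊤ {x = x} (true ∷ Z)  x≥0 = +-monoʳ-≤ (x zero) (tilde-≤-⊤ Z (λ i → x≥0 (suc i) ∘ suc-∉))
tilde-≤-⊤         (false ∷ Z) x≥0 = +-mono-≤ (x≥0 zero λ ()) (tilde-≤-⊤ Z (λ i → x≥0 (suc i) ∘ suc-∉))

tilde-⊤-≤ : ∀ {n} {x : Fin n → ℤ} Z → (∀ i → i ∉ Z → x i ≤ 0ℤ) → tilde x ⊤ ≤ tilde x Z
tilde-⊤-≤         []          _   = ≤-refl
tilde-⊤-≤ {x = x} (true ∷ Z)  x≤0 = +-monoʳ-≤ (x zero) (tilde-⊤-≤ Z (λ i → x≤0 (suc i) ∘ suc-∉))
tilde-⊤-≤         (false ∷ Z) x≤0 = +-mono-≤ (x≤0 zero λ ()) (tilde-⊤-≤ Z (λ i → x≤0 (suc i) ∘ suc-∉))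

δ : ∀ {n} → Fin n → Fin n → ℤ
δ s i = if does (s ≟ᶠ i) then 1ℤ else 0ℤ

δ-self : ∀ {n} (s : Fin n) → δ s s ≡ 1ℤ
δ-self s = cong (if_then 1ℤ else 0ℤ) (dec-true (s ≟ᶠ s) refl)

δ-≢ : ∀ {n} {s i : Fin n} → s ≢ i → δ s i ≡ 0ℤ
δ-≢ {s = s} {i} s≢i = cong (if_then 1ℤ else 0ℤ) (dec-false (s ≟ᶠ i) s≢i)

tilde-δ-∈ : ∀ {n} {s : Fin n} {Z} → s ∈ Z → tilde (δ s) Z ≡ 1ℤ
tilde-δ-∈ {Z = true ∷ Z}  here        = cong (_+_ 1ℤ) (tilde-vanishing Z (λ _ _ → refl))
tilde-δ-∈ {Z = true ∷ Z}  (there s∈Z) = trans (+-identityˡ _) (tilde-δ-∈ s∈Z)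
tilde-δ-∈ {Z = false ∷ Z} (there s∈Z) = trans (+-identityˡ _) (tilde-δ-∈ s∈Z)

tilde-δ-∉ : ∀ {n} {s : Fin n} {Z} → s ∉ Z → tilde (δ s) Z ≡ 0ℤ
tilde-δ-∉ {s = s} {Z} s∉Z = tilde-vanishing Z (λ i i∈Z → δ-≢ {s = s} {i} (λ { refl → s∉Z i∈Z }))

moveUnit : ∀ {n} → Fin n → Fin n → (Fin n → ℤ) → Fin n → ℤ
moveUnit s t x i = x i + δ s i - δ t i

tilde-moveUnit : ∀ {n} (s t : Fin n) x Z
               → tilde (moveUnit s t x) Z ≡ tilde x Z + tilde (δ s) Z - tilde (δ t) Z
tilde-moveUnit s t x Z =
  trans (tilde-+ (λ i → x i + δ s i) (λ i → - δ t i) Z)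
        (cong₂ _+_ (tilde-+ x (δ s) Z) (tilde-neg (δ t) Z))

moveUnit-InB : ∀ {n} (p : Subset n → ℤ∞) {m : Fin n → ℤ} {s t}
             → InB p m → InT p m t s → InB p (moveUnit s t m)
moveUnit-InB p {m} {s} {t} (m-total , m-lower) s∈Tₜ = total , lower
  where
  open ≡-Reasoning
  total : fin (tilde (moveUnit s t m) ⊤) ≡ p ⊤
  total = trans (cong fin (begin
    tilde (moveUnit s t m) ⊤                  ≡⟨ tilde-moveUnit s t m ⊤ ⟩
    tilde m ⊤ + tilde (δ s) ⊤ - tilde (δ t) ⊤ ≡⟨ cong₂ (λ a b → tilde m ⊤ + a - b)
                                                       (tilde-δ-∈ {s = s} ∈⊤) (tilde-δ-∈ {s = t} ∈⊤) ⟩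
    tilde m ⊤ + 1ℤ - 1ℤ                       ≡⟨ i+1-1≡i (tilde m ⊤) ⟩
    tilde m ⊤                                 ∎)) m-total

  lower : ∀ Z → p Z ≤∞ fin (tilde (moveUnit s t m) Z)
  lower Z = subst (λ v → p Z ≤∞ fin v) (sym (tilde-moveUnit s t m Z)) (bound (s ∈? Z) (t ∈? Z))
    where
    a = tilde m Z
    bound : Dec (s ∈ Z) → Dec (t ∈ Z) → p Z ≤∞ fin (a + tilde (δ s) Z - tilde (δ t) Z)
    bound (yes s∈Z) (yes t∈Z) rewrite tilde-δ-∈ s∈Z | tilde-δ-∈ t∈Z =
      ≤∞-trans-≤ (p Z) (m-lower Z) (≤-reflexive (sym (i+1-1≡i a)))
    bound (yes s∈Z) (no t∉Z) rewrite tilde-δ-∈ s∈Z | tilde-δ-∉ t∉Z =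
      ≤∞-trans-≤ (p Z) (m-lower Z) (≤-trans (i≤i+j a 1ℤ) (≤-reflexive (sym (+-identityʳ (a + 1ℤ)))))
    bound (no s∉Z) (no t∉Z) rewrite tilde-δ-∉ s∉Z | tilde-δ-∉ t∉Z =
      ≤∞-trans-≤ (p Z) (m-lower Z) (≤-reflexive (sym (trans (+-identityʳ (a + 0ℤ)) (+-identityʳ a))))
    bound (no s∉Z) (yes t∈Z) rewrite tilde-δ-∉ s∉Z | tilde-δ-∈ t∈Z =
      subst (λ v → p Z ≤∞ fin (v - 1ℤ)) (sym (+-identityʳ a))
        (≤∞∧≢⇒≤-1 (p Z) (m-lower Z) (λ Z-tight → s∉Z (s∈Tₜ Z Z-tight t∈Z)))

countEq-mono : ∀ {n} β (x y : Fin n → ℤ) → (∀ i → x i ≡ β → y i ≡ β) → countEq β x ℕ.≤ countEq β y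
countEq-mono {zero}  β x y _ = ℕ.z≤n
countEq-mono {suc n} β x y x⇒y with x zero ≟ β | y zero ≟ β
... | yes _   | yes _   = ℕ.s≤s (countEq-mono β (x ∘ suc) (y ∘ suc) (x⇒y ∘ suc))
... | yes x₀≡ | no  y₀≢ = ⊥-elim (y₀≢ (x⇒y zero x₀≡))
... | no  _   | yes _   = ℕ.m≤n⇒m≤1+n (countEq-mono β (x ∘ suc) (y ∘ suc) (x⇒y ∘ suc))
... | no  _   | no  _   = countEq-mono β (x ∘ suc) (y ∘ suc) (x⇒y ∘ suc)

countEq-< : ∀ {n} β (x y : Fin n → ℤ) → (∀ i → x i ≡ β → y i ≡ β)
          → ∀ j → y j ≡ β → x j ≢ β → countEq β x ℕ.< countEq β y
countEq-< {suc n} β x y x⇒y j yⱼ≡ xⱼ≢ with x zero ≟ β | y zero ≟ β | j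
... | yes x₀≡ | _       | zero  = ⊥-elim (xⱼ≢ x₀≡)
... | no  _   | yes _   | zero  = ℕ.s≤s (countEq-mono β (x ∘ suc) (y ∘ suc) (x⇒y ∘ suc))
... | no  _   | no  y₀≢ | zero  = ⊥-elim (y₀≢ yⱼ≡)
... | yes x₀≡ | no  y₀≢ | suc _ = ⊥-elim (y₀≢ (x⇒y zero x₀≡))
... | yes _   | yes _   | suc j = ℕ.s≤s (countEq-< β (x ∘ suc) (y ∘ suc) (x⇒y ∘ suc) j yⱼ≡ xⱼ≢)
... | no  _   | yes _   | suc j = ℕ.m≤n⇒m≤1+n (countEq-< β (x ∘ suc) (y ∘ suc) (x⇒y ∘ suc) j yⱼ≡ xⱼ≢)
... | no  _   | no  _   | suc j = countEq-< β (x ∘ suc) (y ∘ suc) (x⇒y ∘ suc) j yⱼ≡ xⱼ≢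

module _ {n} {β : ℤ} (x : Fin n → ℤ) (s t : Fin n) (xₜ≡β : x t ≡ β) (xₛ<β-1 : x s < β - 1ℤ) where

  private
    s≢t : s ≢ t
    s≢t refl = <-irrefl xₜ≡β (<-trans xₛ<β-1 (i-1<i β))

    moved-s : moveUnit s t x s < β
    moved-s = begin-strict
      x s + δ s s - δ t s ≡⟨ cong₂ (λ a b → x s + a - b) (δ-self s) (δ-≢ (s≢t ∘ sym)) ⟩
      x s + 1ℤ - 0ℤ       ≡⟨ +-identityʳ (x s + 1ℤ) ⟩
      x s + 1ℤ            ≤⟨ <⇒+1≤ xₛ<β-1 ⟩
      β - 1ℤ              <⟨ i-1<i β ⟩
      β                   ∎
      where open ≤-Reasoning

    moved-t : moveUnit s t x t < β
    moved-t = begin-strict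
      x t + δ s t - δ t t ≡⟨ cong₂ (λ a b → x t + a - b) (δ-≢ s≢t) (δ-self t) ⟩
      x t + 0ℤ - 1ℤ       ≡⟨ cong (λ a → a + 0ℤ - 1ℤ) xₜ≡β ⟩
      β + 0ℤ - 1ℤ         ≡⟨ cong (_- 1ℤ) (+-identityʳ β) ⟩
      β - 1ℤ              <⟨ i-1<i β ⟩
      β                   ∎
      where open ≤-Reasoning

    moved-other : ∀ {i} → i ≢ s → i ≢ t → moveUnit s t x i ≡ x i
    moved-other {i} i≢s i≢t =
      trans (cong₂ (λ a b → x i + a - b) (δ-≢ (i≢s ∘ sym)) (δ-≢ (i≢t ∘ sym)))
            (trans (+-identityʳ (x i + 0ℤ)) (+-identityʳ (x i)))

  moveUnit-covered : Covered β x → Covered β (moveUnit s t x)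
  moveUnit-covered x≤β i with i ≟ᶠ s | i ≟ᶠ t
  ... | yes refl | _        = <⇒≤ moved-s
  ... | no  _    | yes refl = <⇒≤ moved-t
  ... | no  i≢s  | no  i≢t  = subst (_≤ β) (sym (moved-other i≢s i≢t)) (x≤β i)

  moveUnit-countEq-< : countEq β (moveUnit s t x) ℕ.< countEq β x
  moveUnit-countEq-< = countEq-< β (moveUnit s t x) x β-only-where-x-was t xₜ≡β (<⇒≢ moved-t)
    where
    β-only-where-x-was : ∀ i → moveUnit s t x i ≡ β → x i ≡ β
    β-only-where-x-was i moved≡β with i ≟ᶠ s | i ≟ᶠ t
    ... | yes refl | _        = ⊥-elim (<⇒≢ moved-s moved≡β)
    ... | no  _    | yes refl = xₜ≡β
    ... | no  i≢s  | no  i≢t  = trans (sym (moved-other i≢s i≢t)) moved≡β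

preDecMin⇒S₁-bounded : ∀ {n} (p : Subset n → ℤ∞) β m
                     → PreDecMin p β m → ∀ s → InS1 p β m s → β - 1ℤ ≤ m s
preDecMin⇒S₁-bounded p β m (m∈B , m≤β , minimal) s (t , mₜ≡β , s∈Tₜ) with β - 1ℤ ≤? m s
... | yes β-1≤mₛ = β-1≤mₛ
... | no  β-1≰mₛ = ⊥-elim (ℕ.<⇒≱ (moveUnit-countEq-< m s t mₜ≡β mₛ<β-1)
                            (minimal (moveUnit s t m) (moveUnit-InB p m∈B s∈Tₜ) m′≤β))
  where
  mₛ<β-1 : m s < β - 1ℤ
  mₛ<β-1 = ≰⇒> β-1≰mₛ
  m′≤β : Covered β (moveUnit s t m)
  m′≤β = moveUnit-covered m s t mₜ≡β mₛ<β-1 m≤β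

𝟙[_≡_] : ℤ → ℤ → ℤ
𝟙[ a ≡ β ] = if does (a ≟ β) then 1ℤ else 0ℤ

0≤𝟙 : ∀ a β → 0ℤ ≤ 𝟙[ a ≡ β ]
0≤𝟙 a β with a ≟ β
... | yes _ = +≤+ ℕ.z≤n
... | no  _ = ≤-refl

countEq-as-tilde : ∀ {n} β (x : Fin n → ℤ) → + countEq β x ≡ tilde (λ i → 𝟙[ x i ≡ β ]) ⊤
countEq-as-tilde {zero}  β x = refl
countEq-as-tilde {suc n} β x with x zero ≟ β
... | yes _ = cong (_+_ 1ℤ) (countEq-as-tilde β (x ∘ suc))
... | no  _ = trans (countEq-as-tilde β (x ∘ suc)) (sym (+-identityˡ _))

𝟙-exchange : ∀ {β a b} → β - 1ℤ ≤ a → a ≤ β → b ≤ β → b + 𝟙[ a ≡ β ] ≤ a + 𝟙[ b ≡ β ]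
𝟙-exchange {β} {a} {b} β-1≤a a≤β b≤β with a ≟ β | b ≟ β
... | yes refl | yes refl = ≤-refl
... | yes refl | no  b≢β  = subst (_ ≤_) (sym (+-identityʳ β)) (<⇒+1≤ (≤∧≢⇒< b≤β b≢β))
... | no  _    | yes refl = subst (_≤ _) (trans (i-1+1≡i β) (sym (+-identityʳ β))) (+-monoˡ-≤ 1ℤ β-1≤a)
... | no  _    | no  b≢β  = +-monoˡ-≤ 0ℤ (≤-trans (<⇒≤-1 (≤∧≢⇒< b≤β b≢β)) β-1≤a)

tilde-𝟙-mono : ∀ {n} β (x y : Fin n → ℤ) U → Covered β x → Covered β y
             → (∀ i → i ∈ U → β - 1ℤ ≤ x i) → tilde x U ≤ tilde y U
             → tilde (λ i → 𝟙[ x i ≡ β ]) U ≤ tilde (λ i → 𝟙[ y i ≡ β ]) U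
tilde-𝟙-mono β x y U x≤β y≤β x≥β-1 x̃≤ỹ = +-cancelˡ-≤ (tilde y U) (begin
  tilde y U + tilde 𝟙x U     ≡⟨ tilde-+ y 𝟙x U ⟨
  tilde (λ i → y i + 𝟙x i) U ≤⟨ tilde-mono U (λ i i∈U → 𝟙-exchange (x≥β-1 i i∈U) (x≤β i) (y≤β i)) ⟩
  tilde (λ i → x i + 𝟙y i) U ≡⟨ tilde-+ x 𝟙y U ⟩
  tilde x U + tilde 𝟙y U     ≤⟨ +-monoˡ-≤ (tilde 𝟙y U) x̃≤ỹ ⟩
  tilde y U + tilde 𝟙y U     ∎)
  where
  open ≤-Reasoning
  𝟙x 𝟙y : Fin _ → ℤ
  𝟙x i = 𝟙[ x i ≡ β ]
  𝟙y i = 𝟙[ y i ≡ β ]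

subsets : ∀ n → List (Subset n)
subsets zero    = [] ∷ []
subsets (suc n) = map (true ∷_) (subsets n) ++ map (false ∷_) (subsets n)

∈-subsets : ∀ {n} (X : Subset n) → X ∈ˡ subsets n
∈-subsets []          = here refl
∈-subsets (true ∷ X)  = ∈-++⁺ˡ (∈-map⁺ (true ∷_) (∈-subsets X))
∈-subsets (false ∷ X) = ∈-++⁺ʳ (map (true ∷_) (subsets _)) (∈-map⁺ (false ∷_) (∈-subsets X))

module _ {n ℓ} (P : Subset n → Set ℓ) where

  ⋂-closed : P ⊤ → (∀ {X Y} → P X → P Y → P (X ∩ Y)) → ∀ {Xs} → All P Xs → P (⋂ Xs)
  ⋂-closed P⊤ P∩ []         = P⊤
  ⋂-closed P⊤ P∩ (PX ∷ PXs) = P∩ PX (⋂-closed P⊤ P∩ PXs)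

  ⋃-closed : P ⊥ → (∀ {X Y} → P X → P Y → P (X ∪ Y)) → ∀ {Xs} → All P Xs → P (⋃ Xs)
  ⋃-closed P⊥ P∪ []         = P⊥
  ⋃-closed P⊥ P∪ (PX ∷ PXs) = P∪ PX (⋃-closed P⊥ P∪ PXs)

⋂-⊆ : ∀ {n} {X : Subset n} {Xs} → X ∈ˡ Xs → ⋂ Xs ⊆ X
⋂-⊆ {Xs = X ∷ Xs} (here refl) = p∩q⊆p X (⋂ Xs)
⋂-⊆ {Xs = Y ∷ Xs} (there X∈)  = ⋂-⊆ X∈ ∘ p∩q⊆q Y (⋂ Xs)

⊆-⋃ : ∀ {n} {X : Subset n} {Xs} → X ∈ˡ Xs → X ⊆ ⋃ Xs
⊆-⋃ {Xs = X ∷ Xs} (here refl) = p⊆p∪q (⋃ Xs)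
⊆-⋃ {Xs = Y ∷ Xs} (there X∈)  = q⊆p∪q Y (⋃ Xs) ∘ ⊆-⋃ X∈

∈-⋃⁻ : ∀ {n} {i : Fin n} Xs → i ∈ ⋃ Xs → Any (i ∈_) Xs
∈-⋃⁻ []       i∈⊥ = ⊥-elim (∉⊥ i∈⊥)
∈-⋃⁻ (X ∷ Xs) i∈  with x∈p∪q⁻ X (⋃ Xs) i∈
... | inj₁ i∈X  = here i∈X
... | inj₂ i∈⋃ = there (∈-⋃⁻ Xs i∈⋃)

module TightSets {n} (p : Subset n → ℤ∞) (sup : Supermodular p) (m : Fin n → ℤ) (m∈B : InB p m) where

  tight? : ∀ X → Dec (Tight p m X)
  tight? X = fin (tilde m X) ≟∞ p X

  tight-∩-∪ : ∀ {X Y} → Tight p m X → Tight p m Y → Tight p m (X ∩ Y) × Tight p m (X ∪ Y)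
  tight-∩-∪ {X} {Y} X-tight Y-tight =
    ≤∞-squeeze (p (X ∩ Y)) (p (X ∪ Y)) (proj₂ m∈B (X ∩ Y)) (proj₂ m∈B (X ∪ Y))
      (subst (_≤∞ (p (X ∩ Y) +∞ p (X ∪ Y))) pX+pY≡ (sup X Y))
    where
    pX+pY≡ : p X +∞ p Y ≡ fin (tilde m (X ∩ Y) + tilde m (X ∪ Y))
    pX+pY≡ = trans (cong₂ _+∞_ (sym X-tight) (sym Y-tight)) (cong fin (sym (tilde-∩-∪ m X Y)))

  tightAndContains? : ∀ t X → Dec (Tight p m X × t ∈ X)
  tightAndContains? t X = tight? X ×-dec t ∈? X

  T : Fin n → Subset n
  T t = ⋂ (filter (tightAndContains? t) (subsets n))

  T-tight×∋ : ∀ t → Tight p m (T t) × t ∈ T t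
  T-tight×∋ t = ⋂-closed (λ X → Tight p m X × t ∈ X) (proj₁ m∈B , ∈⊤)
    (λ (X-tight , t∈X) (Y-tight , t∈Y) → proj₁ (tight-∩-∪ X-tight Y-tight) , x∈p∩q⁺ (t∈X , t∈Y))
    (All.all-filter (tightAndContains? t) (subsets n))

  ∈T⇔InT : ∀ t i → i ∈ T t ⇔ InT p m t i
  ∈T⇔InT t i = mk⇔
    (λ i∈T X X-tight t∈X → ⋂-⊆ (∈-filter⁺ (tightAndContains? t) (∈-subsets X) (X-tight , t∈X)) i∈T)
    (λ inT → inT (T t) (proj₁ (T-tight×∋ t)) (proj₂ (T-tight×∋ t)))

  coordsAt : ℤ → List (Fin n)
  coordsAt β = filter (λ t → m t ≟ β) (allFin n)

  S₁ : ℤ → Subset n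
  S₁ β = ⋃ (map T (coordsAt β))

  S₁-tight : p ⊥ ≡ fin 0ℤ → ∀ β → Tight p m (S₁ β)
  S₁-tight p⊥ β = ⋃-closed (Tight p m) ⊥-tight (λ X-tight Y-tight → proj₂ (tight-∩-∪ X-tight Y-tight))
    (All.map⁺ (All.universal (proj₁ ∘ T-tight×∋) (coordsAt β)))
    where
    ⊥-tight : Tight p m ⊥
    ⊥-tight = trans (cong fin (tilde-vanishing {x = m} ⊥ (λ _ → ⊥-elim ∘ ∉⊥))) (sym p⊥)

  ∈S₁⇔InS1 : ∀ β i → i ∈ S₁ β ⇔ InS1 p β m i
  ∈S₁⇔InS1 β i = mk⇔
    (λ i∈S₁ → let t , t∈coords , i∈T = find (Any.map⁻ {f = T} (∈-⋃⁻ (map T (coordsAt β)) i∈S₁))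
              in t , proj₂ (∈-filter⁻ (λ t → m t ≟ β) {xs = allFin n} t∈coords)
                   , Equivalence.to (∈T⇔InT t i) i∈T)
    (λ (t , mₜ≡β , inT) → ⊆-⋃ (∈-map⁺ T (∈-filter⁺ (λ t → m t ≟ β) (∈-allFin t) mₜ≡β))
                                (Equivalence.from (∈T⇔InT t i) inT))

  ≡β⇒∈S₁ : ∀ {β i} → m i ≡ β → i ∈ S₁ β
  ≡β⇒∈S₁ {β} {i} mᵢ≡β = Equivalence.from (∈S₁⇔InS1 β i) (i , mᵢ≡β , λ _ _ i∈X → i∈X)

S₁-bounded⇒preDecMin : ∀ {n} (p : Subset n → ℤ∞) → Supermodular p → p ⊥ ≡ fin 0ℤ
                     → ∀ β m → InB p m → Covered β m
                     → (∀ s → InS1 p β m s → β - 1ℤ ≤ m s) → PreDecMin p β m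
S₁-bounded⇒preDecMin p sup p⊥ β m m∈B m≤β bounded = m∈B , m≤β , minimal
  where
  open TightSets p sup m m∈B
  minimal : ∀ y → InB p y → Covered β y → countEq β m ℕ.≤ countEq β y
  minimal y (_ , y-lower) y≤β = drop‿+≤+ (begin
    + countEq β m                     ≡⟨ countEq-as-tilde β m ⟩
    tilde (λ i → 𝟙[ m i ≡ β ]) ⊤      ≤⟨ tilde-⊤-≤ (S₁ β) (λ i → ≤-reflexive ∘ 𝟙-outside) ⟩
    tilde (λ i → 𝟙[ m i ≡ β ]) (S₁ β) ≤⟨ tilde-𝟙-mono β m y (S₁ β) m≤β y≤β m≥β-1 m̃≤ỹ ⟩
    tilde (λ i → 𝟙[ y i ≡ β ]) (S₁ β) ≤⟨ tilde-≤-⊤ (S₁ β) (λ i _ → 0≤𝟙 (y i) β) ⟩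
    tilde (λ i → 𝟙[ y i ≡ β ]) ⊤      ≡⟨ countEq-as-tilde β y ⟨
    + countEq β y                     ∎)
    where
    open ≤-Reasoning
    m≥β-1 : ∀ i → i ∈ S₁ β → β - 1ℤ ≤ m i
    m≥β-1 i = bounded i ∘ Equivalence.to (∈S₁⇔InS1 β i)
    m̃≤ỹ : tilde m (S₁ β) ≤ tilde y (S₁ β)
    m̃≤ỹ = subst (_≤∞ fin (tilde y (S₁ β))) (sym (S₁-tight p⊥ β)) (y-lower (S₁ β))
    𝟙-outside : ∀ {i} → i ∉ S₁ β → 𝟙[ m i ≡ β ] ≡ 0ℤ
    𝟙-outside {i} i∉S₁ = cong (if_then 1ℤ else 0ℤ) (dec-false (m i ≟ β) (i∉S₁ ∘ ≡β⇒∈S₁))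

theorem4p2 : (k : ℕ) (p : Subset (suc k) → ℤ∞)
    → Supermodular p → p ⊥ ≡ fin 0ℤ → (∃ λ c → p ⊤ ≡ fin c)
    → (β₁ : ℤ) → IsBeta1 p β₁
    → (m : Fin (suc k) → ℤ) → InB p m → Covered β₁ m
    → PreDecMin p β₁ m ⇔ (∀ s → InS1 p β₁ m s → β₁ - 1ℤ ≤ m s)
theorem4p2 k p sup p⊥ _ β₁ _ m m∈B m≤β₁ =
  mk⇔ (preDecMin⇒S₁-bounded p β₁ m) (S₁-bounded⇒preDecMin p sup p⊥ β₁ m m∈B m≤β₁)
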